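{- Let $P=a_1a_2\dots a_r$ be a $\Sigma$-pattern with $a_1\in\Sigma$ and exactly one gap such that $\mathrm{T}(P)$ is completely additive and not the constant zero sequence, and suppose $r=p^k$ with $p$ prime and $k\ge2$. Then $P=Q^{(k)}$ where $Q=a_1a_2\dots a_{p-1}\,\rho_{a_p}$.
   Context: $\Sigma$ is a finite cyclic group; gaps are bijections of $\Sigma$, $?$ the identity, $\rho_d$ the bijection $x\mapsto x+d$. For words $x,y$ over $\Sigma\cup\mathrm{S}_\Sigma$: $x\langle\varepsilon\rangle=x$, $(a\,x)\langle y\rangle=a\,x\langle y\rangle$, $(f\,x)\langle b\,y\rangle=f(b)\,x\langle y\rangle$, $(f\,x)\langle g\,y\rangle=(f\circ g)\,x\langle y\rangle$. For $P$ with first symbol in $\Sigma$: $T_0=?^\omega$, $T_{i+1}=P^\omega\langle T_i\rangle$, $\mathrm{T}(P)=\lim T_i$. Completely additive: $\sigma(1)=0$, $\sigma(nm)=\sigma(n)+\sigma(m)$. With $\xi(n,m)=m/\gcd(n,m)$ and $|P|_?$ the number of gaps: $P\circ Q=P$ if $|P|_?=0$, else $P\circ Q=P^{d_1}\langle Q^{d_2}\rangle$ with $d_1=\xi(|P|_?,|Q|)$, $d_2=\xi(|Q|,|P|_?)$; $Q^{(0)}=?$, $Q^{(n+1)}=Q\circ Q^{(n)}$. Convention: if $\mathrm{T}(P)$ is not surjective, a gap is identified with every bijection agreeing with it on letters occurring in $\mathrm{T}(P)$; equality of patterns is modulo this identification. -}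

module Defs where

open import Data.Nat using (ℕ; zero; suc; _+_; _*_; _∸_; _≤_; _%_; _/_)
open import Data.Nat.DivMod using (_mod_)
open import Data.Nat.GCD using (gcd)
open import Data.Fin using (Fin; toℕ)
open import Data.Sum using (_⊎_; inj₁; inj₂)
open import Data.Product using (_×_; ∃; ∃-syntax)
open import Data.List using (List; []; _∷_; concat; replicate; length)
open import Data.List.Relation.Binary.Pointwise using (Pointwise)
open import Data.Unit using (⊤)
open import Data.Empty using (⊥)
open import Function using (_∘_; id)
open import Function.Definitions using (Bijective)
open import Relation.Binary.PropositionalEquality using (_≡_)

-- The finite cyclic group Σ is modelled as ℤ/(suc N)ℤ = Fin (suc N).
module _ (N : ℕ) where

  Σ' : Set
  Σ' = Fin (suc N)

  _⊕_ : Σ' → Σ' → Σ'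
  a ⊕ b = (toℕ a + toℕ b) mod (suc N)

  ρ : Σ' → (Σ' → Σ')
  ρ d x = x ⊕ d

  -- Symbols: letters (inj₁) or gaps (inj₂); gaps are functions Σ → Σ
  -- (bijectivity of gaps in a pattern is imposed by IsPattern).
  Sym : Set
  Sym = Σ' ⊎ (Σ' → Σ')

  gapId : Sym
  gapId = inj₂ id

  BijGap : Sym → Set
  BijGap (inj₁ _) = ⊤
  BijGap (inj₂ f) = Bijective _≡_ _≡_ f

  IsPattern : List Sym → Set
  IsPattern [] = ⊤
  IsPattern (s ∷ w) = BijGap s × IsPattern w

  isGap : Sym → ℕ
  isGap (inj₁ _) = 0
  isGap (inj₂ _) = 1

  gapCount : List Sym → ℕ
  gapCount [] = 0
  gapCount (s ∷ w) = isGap s + gapCount w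

  apply : (Σ' → Σ') → Sym → Sym
  apply f (inj₁ b) = inj₁ (f b)
  apply f (inj₂ g) = inj₂ (f ∘ g)

  fill : List Sym → List Sym → List Sym
  fill x [] = x
  fill [] (_ ∷ _) = []
  fill (inj₁ a ∷ x) (b ∷ y) = inj₁ a ∷ fill x (b ∷ y)
  fill (inj₂ f ∷ x) (b ∷ y) = apply f b ∷ fill x y

  -- x⟨y⟩ for infinite words (sequences ℕ → Sym, 0-indexed):
  -- the gap at position j of x is filled with the symbol of y whose index
  -- is the number of gaps of x strictly before position j.
  gapsBefore : (ℕ → Sym) → ℕ → ℕ
  gapsBefore x zero = 0
  gapsBefore x (suc j) = gapsBefore x j + isGap (x j)

  fillω : (ℕ → Sym) → (ℕ → Sym) → ℕ → Sym
  fillω x y j with x j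
  ... | inj₁ a = inj₁ a
  ... | inj₂ f = apply f (y (gapsBefore x j))

  nth : List Sym → ℕ → Sym
  nth [] _ = gapId
  nth (s ∷ w) zero = s
  nth (s ∷ w) (suc j) = nth w j

  omega : List Sym → ℕ → Sym
  omega P j with length P
  ... | zero = gapId
  ... | suc r = nth P (j % suc r)

  Tstage : List Sym → ℕ → ℕ → Sym
  Tstage P zero = λ _ → gapId
  Tstage P (suc i) = fillω (omega P) (Tstage P i)

  -- σ (a sequence of letters, 0-indexed) is the limit of the T_i
  IsToeplitzLimit : List Sym → (ℕ → Σ') → Set
  IsToeplitzLimit P σ =
    ∀ j → ∃[ i₀ ] (∀ i → i₀ ≤ i → Tstage P i j ≡ inj₁ (σ j))

  -- completely additive, for a sequence t indexed from 1 (t 0 is ignored)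
  CompletelyAdditive : (ℕ → Σ') → Set
  CompletelyAdditive t =
    (t 1 ≡ Fin.zero) × (∀ a b → t (suc a * suc b) ≡ t (suc a) ⊕ t (suc b))

  ξ : ℕ → ℕ → ℕ
  ξ n m with gcd n m
  ... | zero = zero
  ... | suc g = m / suc g

  pow : List Sym → ℕ → List Sym
  pow P d = concat (replicate d P)

  _⊚_ : List Sym → List Sym → List Sym
  P ⊚ Q with gapCount P
  ... | zero = P
  ... | suc g = fill (pow P (ξ (suc g) (length Q))) (pow Q (ξ (length Q) (suc g)))

  iter : List Sym → ℕ → List Sym
  iter Q zero = gapId ∷ []
  iter Q (suc n) = Q ⊚ iter Q n

  -- equality of symbols modulo the identification convention: gaps are
  -- equal iff they agree on every letter occurring in T(P) (= σ).
  SymEq : (ℕ → Σ') → Sym → Sym → Set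
  SymEq σ (inj₁ a) (inj₁ b) = a ≡ b
  SymEq σ (inj₂ f) (inj₂ g) = ∀ x → (∃[ j ] σ j ≡ x) → f x ≡ g x
  SymEq σ _ _ = ⊥

  PatEq : (ℕ → Σ') → List Sym → List Sym → Set
  PatEq σ = Pointwise (SymEq σ)

module Submission where

-- Indices are 0-based: σ j is the letter at position j+1 of T(P), so complete
-- additivity reads  σ(b + a(b+1)) = σ a ⊕ σ b.  Put r = p^k = r' + 1.
-- Both sides are compared through one normal form, Shape c: the word
-- σ₀ σ₁ … σ_{c-1} followed by a gap g with g(σ q) = σ(c + q(c+1)).  Two words
-- of the same Shape are equal modulo the identification of gaps agreeing on
-- the letters of σ.
--  * P has Shape r'.  Every letter of P recurs with period r in σ; were the
--    last symbol a letter, additivity would force σ ≡ 0.  So the gap is last,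
--    and the Toeplitz construction fills it at r' + qr with the value at q.
--  * Periodicity of σ below r' and additivity give σ(s + ip) = σ s for
--    s < p-1.  Hence replacing every symbol x of a word of Shape c by the block
--    a₁ … a_{p-1} ρ_{a_p}(x) yields a word of Shape (c+1)p - 1; since Q^(n+1)
--    is exactly this substitution applied to Q^(n), Q^(k) has Shape r'.

open import Defs
open import Data.Nat using (ℕ; zero; suc; _∸_; _≤_; _^_)
open import Data.Nat.Primality using (Prime)
open import Data.Fin using (Fin)
open import Data.Sum using (inj₁; inj₂)
open import Data.Product using (_×_; ∃-syntax)
open import Data.List using (List; []; _∷_; _++_; take; length)
open import Relation.Nullary using (¬_)
open import Relation.Binary.PropositionalEquality using (_≡_)

open import Data.Nat using (_+_; _*_; _<_; _%_; _/_; pred; s≤s; z≤n; nonTrivial⇒n>1)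
open import Data.Nat.Properties
open import Data.Nat.DivMod
  using (m≡m%n+[m/n]*n; m%n<n; m<n⇒m%n≡m; [m+kn]%n≡m%n; [m+n]%n≡m%n; %-distribˡ-+; m%n%n≡m%n; n/1≡n)
open import Data.Nat.GCD using (gcd; gcd[m,n]∣m; gcd[m,n]∣n)
open import Data.Nat.Divisibility using (∣1⇒≡1)
open import Data.Nat.Primality using (prime⇒nonTrivial)
open import Data.Nat.Tactic.RingSolver using (solve-∀)
open import Data.Fin using (toℕ)
open import Data.Fin.Properties using (toℕ-fromℕ<; toℕ-injective; toℕ<n)
open import Data.Sum.Properties using (inj₁-injective)
open import Data.Product using (_,_; proj₂)
open import Data.List using (concatMap)
open import Data.List.Properties using (++-assoc; ++-identityʳ; length-++; length-take)
open import Data.List.Relation.Binary.Pointwise using ([]; _∷_)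
open import Relation.Binary.PropositionalEquality
  using (refl; sym; trans; cong; cong₂; subst; module ≡-Reasoning)
open import Data.Empty using (⊥-elim)
open import Function using (_∘_; id)

open ≡-Reasoning

PeriodicBelow : {A : Set} → (ℕ → A) → ℕ → Set
PeriodicBelow σ c = ∀ j q → j < c → σ (j + q * suc c) ≡ σ j

module CyclicGroup (N : ℕ) where

  toℕ-⊕ : ∀ a b → toℕ (_⊕_ N a b) ≡ (toℕ a + toℕ b) % suc N
  toℕ-⊕ a b = toℕ-fromℕ< _

  ⊕-identityʳ : ∀ x → _⊕_ N x Fin.zero ≡ x
  ⊕-identityʳ x = toℕ-injective (begin
    toℕ (_⊕_ N x Fin.zero)  ≡⟨ toℕ-⊕ x Fin.zero ⟩
    (toℕ x + 0) % suc N     ≡⟨ cong (_% suc N) (+-identityʳ (toℕ x)) ⟩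
    toℕ x % suc N           ≡⟨ m<n⇒m%n≡m (toℕ<n x) ⟩
    toℕ x                   ∎)

  %-undo : ∀ c a → c ≤ suc N → a < suc N → ((suc N ∸ c) + (c + a) % suc N) % suc N ≡ a
  %-undo c a c≤n a<n = begin
    ((n ∸ c) + (c + a) % n) % n            ≡⟨ %-distribˡ-+ (n ∸ c) ((c + a) % n) n ⟩
    ((n ∸ c) % n + (c + a) % n % n) % n    ≡⟨ cong (λ z → ((n ∸ c) % n + z) % n) (m%n%n≡m%n (c + a) n) ⟩
    ((n ∸ c) % n + (c + a) % n) % n        ≡⟨ %-distribˡ-+ (n ∸ c) (c + a) n ⟨
    ((n ∸ c) + (c + a)) % n                ≡⟨ cong (_% n) (+-assoc (n ∸ c) c a) ⟨
    ((n ∸ c) + c + a) % n                  ≡⟨ cong (λ z → (z + a) % n) (m∸n+n≡m c≤n) ⟩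
    (n + a) % n                            ≡⟨ cong (_% n) (+-comm n a) ⟩
    (a + n) % n                            ≡⟨ [m+n]%n≡m%n a n ⟩
    a % n                                  ≡⟨ m<n⇒m%n≡m a<n ⟩
    a                                      ∎
    where
    n : ℕ
    n = suc N

  ⊕-cancelˡ : ∀ c {a b} → _⊕_ N c a ≡ _⊕_ N c b → a ≡ b
  ⊕-cancelˡ c {a} {b} eq = toℕ-injective (begin
    toℕ a                                          ≡⟨ %-undo (toℕ c) (toℕ a) c≤n (toℕ<n a) ⟨
    ((suc N ∸ toℕ c) + (toℕ c + toℕ a) % suc N) % suc N
      ≡⟨ cong (λ z → ((suc N ∸ toℕ c) + z) % suc N) sums ⟩
    ((suc N ∸ toℕ c) + (toℕ c + toℕ b) % suc N) % suc N
      ≡⟨ %-undo (toℕ c) (toℕ b) c≤n (toℕ<n b) ⟩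
    toℕ b                                          ∎)
    where
    c≤n : toℕ c ≤ suc N
    c≤n = <⇒≤ (toℕ<n c)
    sums : (toℕ c + toℕ a) % suc N ≡ (toℕ c + toℕ b) % suc N
    sums = trans (sym (toℕ-⊕ c a)) (trans (cong toℕ eq) (toℕ-⊕ c b))

module Words (N : ℕ) where

  HasLetter : List (Sym N) → ℕ → Set
  HasLetter xs j = ∃[ a ] nth N xs j ≡ inj₁ a

  nth-++ˡ : ∀ (xs ys : List (Sym N)) {j} → j < length xs → nth N (xs ++ ys) j ≡ nth N xs j
  nth-++ˡ (x ∷ xs) ys {zero} _ = refl
  nth-++ˡ (x ∷ xs) ys {suc j} (s≤s j<) = nth-++ˡ xs ys j<

  nth-++ʳ : ∀ (xs ys : List (Sym N)) j → nth N (xs ++ ys) (length xs + j) ≡ nth N ys j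
  nth-++ʳ [] ys j = refl
  nth-++ʳ (x ∷ xs) ys j = nth-++ʳ xs ys j

  nth-take : ∀ n (xs : List (Sym N)) {j} → j < n → nth N (take n xs) j ≡ nth N xs j
  nth-take (suc n) [] _ = refl
  nth-take (suc n) (x ∷ xs) {zero} _ = refl
  nth-take (suc n) (x ∷ xs) {suc j} (s≤s j<n) = nth-take n xs j<n

  letters⇒gapFree : ∀ xs → (∀ j → j < length xs → HasLetter xs j) → gapCount N xs ≡ 0
  letters⇒gapFree [] _ = refl
  letters⇒gapFree (inj₁ a ∷ xs) letters = letters⇒gapFree xs (λ j j< → letters (suc j) (s≤s j<))
  letters⇒gapFree (inj₂ f ∷ xs) letters with letters 0 (s≤s z≤n)
  ... | _ , ()

  gapFree⇒letters : ∀ xs → gapCount N xs ≡ 0 → ∀ j → j < length xs → HasLetter xs j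
  gapFree⇒letters (inj₁ a ∷ xs) _ zero _ = a , refl
  gapFree⇒letters (inj₁ a ∷ xs) e (suc j) (s≤s j<) = gapFree⇒letters xs e j j<
  gapFree⇒letters (inj₂ f ∷ xs) ()

  letters-before-gap : ∀ xs g {f} → gapCount N xs ≡ 1 → g < length xs → nth N xs g ≡ inj₂ f →
    ∀ j → j < g → HasLetter xs j
  letters-before-gap (inj₁ a ∷ xs) g _ _ _ zero _ = a , refl
  letters-before-gap (inj₁ a ∷ xs) (suc g) e (s≤s g<) gap (suc j) (s≤s j<g) =
    letters-before-gap xs g e g< gap j j<g
  letters-before-gap (inj₂ h ∷ xs) (suc g) e (s≤s g<) gap j _
    with gapFree⇒letters xs (suc-injective e) g g<
  ... | a , letter with trans (sym letter) gap
  ... | ()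

  nth⇒PatEq : ∀ {σ} (xs ys : List (Sym N)) → length xs ≡ length ys →
    (∀ j → j < length xs → SymEq N σ (nth N xs j) (nth N ys j)) → PatEq N σ xs ys
  nth⇒PatEq [] [] _ _ = []
  nth⇒PatEq (x ∷ xs) (y ∷ ys) e same =
    same 0 (s≤s z≤n) ∷ nth⇒PatEq xs ys (suc-injective e) (λ j j< → same (suc j) (s≤s j<))

  fillω-letter : ∀ (x y : ℕ → Sym N) j {a} → x j ≡ inj₁ a → fillω N x y j ≡ inj₁ a
  fillω-letter x y j eq rewrite eq = refl

  fillω-gap : ∀ (x y : ℕ → Sym N) j {f} → x j ≡ inj₂ f →
    fillω N x y j ≡ apply N f (y (gapsBefore N x j))
  fillω-gap x y j eq rewrite eq = refl

  module BlockSubstitution {p : ℕ} (block : Sym N → List (Sym N))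
                           (length-block : ∀ x → length (block x) ≡ p) where

    length-concatMap : ∀ R → length (concatMap block R) ≡ length R * p
    length-concatMap [] = refl
    length-concatMap (x ∷ R) =
      trans (length-++ (block x)) (cong₂ _+_ (length-block x) (length-concatMap R))

    nth-concatMap : ∀ R i s → i < length R → s < p →
      nth N (concatMap block R) (s + i * p) ≡ nth N (block (nth N R i)) s
    nth-concatMap (x ∷ R) zero s _ s<p = begin
      nth N (block x ++ concatMap block R) (s + 0)  ≡⟨ cong (nth N (block x ++ concatMap block R)) (+-identityʳ s) ⟩
      nth N (block x ++ concatMap block R) s        ≡⟨ nth-++ˡ (block x) _ (subst (s <_) (sym (length-block x)) s<p) ⟩
      nth N (block x) s                             ∎
    nth-concatMap (x ∷ R) (suc i) s (s≤s i<) s<p = begin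
      nth N (block x ++ concatMap block R) (s + (p + i * p))
        ≡⟨ cong (nth N (block x ++ concatMap block R)) (trans (+-swap s p (i * p)) (cong (_+ (s + i * p)) (sym (length-block x)))) ⟩
      nth N (block x ++ concatMap block R) (length (block x) + (s + i * p))
        ≡⟨ nth-++ʳ (block x) _ (s + i * p) ⟩
      nth N (concatMap block R) (s + i * p)
        ≡⟨ nth-concatMap R i s i< s<p ⟩
      nth N (block (nth N R i)) s
        ∎
      where
      +-swap : ∀ a b c → a + (b + c) ≡ b + (a + c)
      +-swap = solve-∀

  -- With a single gap in P, P ∘ R = P^{|R|}⟨R⟩ since ξ(1, n) = n, ξ(n, 1) = 1.
  ξ-oneˡ : ∀ n → ξ N 1 n ≡ n
  ξ-oneˡ n with gcd 1 n | ∣1⇒≡1 (gcd[m,n]∣m 1 n)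
  ... | .1 | refl = n/1≡n n

  ξ-oneʳ : ∀ n → ξ N n 1 ≡ 1
  ξ-oneʳ n with gcd n 1 | ∣1⇒≡1 (gcd[m,n]∣n n 1)
  ... | .1 | refl = refl

  gapCount-∷ʳ-gap : ∀ L h → gapCount N L ≡ 0 → gapCount N (L ++ inj₂ h ∷ []) ≡ 1
  gapCount-∷ʳ-gap [] h _ = refl
  gapCount-∷ʳ-gap (inj₁ a ∷ L) h e = gapCount-∷ʳ-gap L h e

  -- For Q = L ?_h with L gap-free, filling |R| copies of Q with R replaces
  -- every symbol x of R by the block L h(x); so Q^(n+1) is Q^(n) block-substituted.
  module LastGap (L : List (Sym N)) (h : Σ' N → Σ' N) (gapFree-L : gapCount N L ≡ 0) where

    Q : List (Sym N)
    Q = L ++ inj₂ h ∷ []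

    block : Sym N → List (Sym N)
    block x = L ++ apply N h x ∷ []

    fill-step : ∀ L' X s Y → gapCount N L' ≡ 0 →
      fill N (L' ++ inj₂ h ∷ X) (s ∷ Y) ≡ L' ++ apply N h s ∷ fill N X Y
    fill-step [] X s Y _ = refl
    fill-step (inj₁ a ∷ L') X s Y e = cong (inj₁ a ∷_) (fill-step L' X s Y e)

    fill-blocks : ∀ R → fill N (pow N Q (length R)) R ≡ concatMap block R
    fill-blocks [] = refl
    fill-blocks (s ∷ R) = begin
      fill N (Q ++ pow N Q (length R)) (s ∷ R)
        ≡⟨ cong (λ w → fill N w (s ∷ R)) (++-assoc L (inj₂ h ∷ []) _) ⟩
      fill N (L ++ inj₂ h ∷ pow N Q (length R)) (s ∷ R)
        ≡⟨ fill-step L _ s R gapFree-L ⟩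
      L ++ apply N h s ∷ fill N (pow N Q (length R)) R
        ≡⟨ cong (λ w → L ++ apply N h s ∷ w) (fill-blocks R) ⟩
      L ++ apply N h s ∷ concatMap block R
        ≡⟨ ++-assoc L (apply N h s ∷ []) _ ⟨
      block s ++ concatMap block R
        ∎

    iter-unfold : ∀ n → iter N Q (suc n) ≡ concatMap block (iter N Q n)
    iter-unfold n rewrite gapCount-∷ʳ-gap L h gapFree-L = begin
      fill N (pow N Q (ξ N 1 (length R))) (pow N R (ξ N (length R) 1))
        ≡⟨ cong₂ (λ u v → fill N (pow N Q u) (pow N R v)) (ξ-oneˡ (length R)) (ξ-oneʳ (length R)) ⟩
      fill N (pow N Q (length R)) (R ++ [])
        ≡⟨ cong (fill N (pow N Q (length R))) (++-identityʳ R) ⟩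
      fill N (pow N Q (length R)) R
        ≡⟨ fill-blocks R ⟩
      concatMap block R
        ∎
      where
      R : List (Sym N)
      R = iter N Q n

module ToeplitzWord (N : ℕ) (P : List (Sym N)) (r' : ℕ) (length-P : length P ≡ suc r')
                    (σ : ℕ → Σ' N) (limit : IsToeplitzLimit N P σ) where

  open Words N

  omega-nth : ∀ j → omega N P j ≡ nth N P (j % suc r')
  omega-nth j rewrite length-P = refl

  omega-periodic : ∀ q s → s < suc r' → omega N P (s + q * suc r') ≡ nth N P s
  omega-periodic q s s<r = trans (omega-nth (s + q * suc r'))
    (cong (nth N P) (trans ([m+kn]%n≡m%n s q (suc r')) (m<n⇒m%n≡m s<r)))

  -- A letter of P^ω is already fixed in T₁, hence it is the limit value.
  σ-at-letter : ∀ j {a} → omega N P j ≡ inj₁ a → σ j ≡ a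
  σ-at-letter j letter with limit j
  ... | i₀ , stable = inj₁-injective (begin
    inj₁ (σ j)                  ≡⟨ stable (suc i₀) (n≤1+n i₀) ⟨
    Tstage N P (suc i₀) j       ≡⟨ fillω-letter (omega N P) (Tstage N P i₀) j letter ⟩
    inj₁ _                      ∎)

  letter-periodic : ∀ q s {a} → s < suc r' → nth N P s ≡ inj₁ a → σ (s + q * suc r') ≡ a
  letter-periodic q s s<r letter = σ-at-letter _ (trans (omega-periodic q s s<r) letter)

  σ-at-position : ∀ s {a} → s < suc r' → nth N P s ≡ inj₁ a → σ s ≡ a
  σ-at-position s s<r letter =
    σ-at-letter s (trans (omega-nth s) (trans (cong (nth N P) (m<n⇒m%n≡m s<r)) letter))

  module GapLast (letters : ∀ s → s < r' → HasLetter P s) {f} (last-gap : nth N P r' ≡ inj₂ f) where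

    gaps-before-block : ∀ q s → s < suc r' → gapsBefore N (omega N P) (s + q * suc r') ≡ q
    gaps-before-block zero zero _ = refl
    gaps-before-block (suc q) zero _ = begin
      gapsBefore N (omega N P) (r' + q * suc r') + isGap N (omega N P (r' + q * suc r'))
        ≡⟨ cong₂ _+_ (gaps-before-block q r' (n<1+n r'))
                     (cong (isGap N) (trans (omega-periodic q r' (n<1+n r')) last-gap)) ⟩
      q + 1
        ≡⟨ +-comm q 1 ⟩
      suc q
        ∎
    gaps-before-block q (suc s) (s≤s s<r) with letters s s<r
    ... | a , letter = begin
      gapsBefore N (omega N P) (s + q * suc r') + isGap N (omega N P (s + q * suc r'))
        ≡⟨ cong₂ _+_ (gaps-before-block q s (m<n⇒m<1+n s<r))
                     (cong (isGap N) (trans (omega-periodic q s (m<n⇒m<1+n s<r)) letter)) ⟩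
      q + 0
        ≡⟨ +-identityʳ q ⟩
      q
        ∎

    -- once T_i has stabilised at q, T_{i+1} holds f (σ q) at r' + q(r'+1)
    σ-at-gap : ∀ q → σ (r' + q * suc r') ≡ f (σ q)
    σ-at-gap q with limit (r' + q * suc r') | limit q
    ... | i₂ , stable₂ | i₁ , stable₁ = inj₁-injective (begin
      inj₁ (σ j)
        ≡⟨ stable₂ (suc i) (≤-trans (m≤n+m i₂ i₁) (n≤1+n i)) ⟨
      Tstage N P (suc i) j
        ≡⟨ fillω-gap (omega N P) (Tstage N P i) j (trans (omega-periodic q r' (n<1+n r')) last-gap) ⟩
      apply N f (Tstage N P i (gapsBefore N (omega N P) j))
        ≡⟨ cong (λ z → apply N f (Tstage N P i z)) (gaps-before-block q r' (n<1+n r')) ⟩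
      apply N f (Tstage N P i q)
        ≡⟨ cong (apply N f) (stable₁ i (m≤m+n i₁ i₂)) ⟩
      inj₁ (f (σ q))
        ∎)
      where
      j i : ℕ
      j = r' + q * suc r'
      i = i₁ + i₂

module Additive (N : ℕ) (σ : ℕ → Σ' N) (additive : CompletelyAdditive N (λ m → σ (m ∸ 1))) where

  open CyclicGroup N

  -- t((a+1)(b+1)) = t(a+1) + t(b+1) in 0-based indexing
  σ-mul : ∀ a b → σ (b + a * suc b) ≡ _⊕_ N (σ a) (σ b)
  σ-mul = proj₂ additive

  -- If σ is (c+1)-periodic at position c, then σ vanishes identically:
  -- first σ c ⊕ σ c = σ(c + c(c+1)) = σ c gives σ c = 0, then
  -- σ m = σ m ⊕ σ c = σ(c + m(c+1)) = σ c = 0.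
  periodic-at⇒zero : ∀ c → (∀ q → σ (c + q * suc c) ≡ σ c) → ∀ m → σ m ≡ Fin.zero
  periodic-at⇒zero c periodic m = begin
    σ m                      ≡⟨ ⊕-identityʳ (σ m) ⟨
    _⊕_ N (σ m) Fin.zero     ≡⟨ cong (_⊕_ N (σ m)) σc≡0 ⟨
    _⊕_ N (σ m) (σ c)        ≡⟨ σ-mul m c ⟨
    σ (c + m * suc c)        ≡⟨ periodic m ⟩
    σ c                      ≡⟨ σc≡0 ⟩
    Fin.zero                 ∎
    where
    σc≡0 : σ c ≡ Fin.zero
    σc≡0 = ⊕-cancelˡ (σ c) (begin
      _⊕_ N (σ c) (σ c)      ≡⟨ σ-mul c c ⟨
      σ (c + c * suc c)      ≡⟨ periodic c ⟩
      σ c                    ≡⟨ ⊕-identityʳ (σ c) ⟨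
      _⊕_ N (σ c) Fin.zero   ∎)

  -- Multiplying by e'+1 moves position
  -- s + i(p'+1) to (s + e'(s+1)) + i r with s + e'(s+1) < r'.
  block-periodic : ∀ p' e' → PeriodicBelow σ (e' + p' * suc e') →
    ∀ s i → s < p' → σ (s + i * suc p') ≡ σ s
  block-periodic p' e' periodic s i s<p' = ⊕-cancelˡ (σ e') (begin
    _⊕_ N (σ e') (σ (s + i * suc p'))            ≡⟨ σ-mul e' (s + i * suc p') ⟨
    σ ((s + i * suc p') + e' * suc (s + i * suc p'))
      ≡⟨ cong σ (regroup s i p' e') ⟩
    σ ((s + e' * suc s) + i * suc (e' + p' * suc e'))
      ≡⟨ periodic (s + e' * suc s) i small ⟩
    σ (s + e' * suc s)                           ≡⟨ σ-mul e' s ⟩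
    _⊕_ N (σ e') (σ s)                           ∎)
    where
    regroup : ∀ s i p' e' →
      (s + i * suc p') + e' * suc (s + i * suc p') ≡ (s + e' * suc s) + i * suc (e' + p' * suc e')
    regroup = solve-∀
    small : s + e' * suc s < e' + p' * suc e'
    small = ≤-trans (*-monoʳ-≤ (suc e') s<p')
              (≤-trans (≤-reflexive (*-comm (suc e') p')) (m≤n+m (p' * suc e') e'))

  shift-by : ∀ p' c q →
    ρ N (σ p') (σ (c + q * suc c)) ≡ σ ((p' + c * suc p') + q * suc (p' + c * suc p'))
  shift-by p' c q = begin
    _⊕_ N (σ (c + q * suc c)) (σ p')          ≡⟨ σ-mul (c + q * suc c) p' ⟨
    σ (p' + (c + q * suc c) * suc p')         ≡⟨ cong σ (regroup p' c q) ⟩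
    σ ((p' + c * suc p') + q * suc (p' + c * suc p')) ∎
    where
    regroup : ∀ p' c q →
      p' + (c + q * suc c) * suc p' ≡ (p' + c * suc p') + q * suc (p' + c * suc p')
    regroup = solve-∀

record Shape (N : ℕ) (σ : ℕ → Σ' N) (c : ℕ) (R : List (Sym N)) : Set where
  field
    length≡ : length R ≡ suc c
    letter : ∀ j → j < c → nth N R j ≡ inj₁ (σ j)
    gap : Σ' N → Σ' N
    gap-at-end : nth N R c ≡ inj₂ gap
    gap-on-σ : ∀ q → gap (σ q) ≡ σ (c + q * suc c)

shape⇒PatEq : ∀ {N σ c R₁ R₂} → Shape N σ c R₁ → Shape N σ c R₂ → PatEq N σ R₁ R₂
shape⇒PatEq {N} {σ} {c} {R₁} {R₂} S₁ S₂ =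
  nth⇒PatEq R₁ R₂ (trans S₁.length≡ (sym S₂.length≡)) same
  where
  open Words N
  module S₁ = Shape S₁
  module S₂ = Shape S₂
  gaps-agree : SymEq N σ (inj₂ S₁.gap) (inj₂ S₂.gap)
  gaps-agree x (q , refl) = trans (S₁.gap-on-σ q) (sym (S₂.gap-on-σ q))
  same : ∀ j → j < length R₁ → SymEq N σ (nth N R₁ j) (nth N R₂ j)
  same j j<r with m≤n⇒m<n∨m≡n (≤-pred (subst (j <_) S₁.length≡ j<r))
  ... | inj₁ j<c rewrite S₁.letter j j<c | S₂.letter j j<c = refl
  ... | inj₂ refl rewrite S₁.gap-at-end | S₂.gap-at-end = gaps-agree

-- The pattern itself has Shape r': its gap is last because σ is not zero.
pattern-shape : ∀ N (P : List (Sym N)) r' → length P ≡ suc r' → gapCount N P ≡ 1 →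
  (σ : ℕ → Σ' N) → IsToeplitzLimit N P σ → CompletelyAdditive N (λ m → σ (m ∸ 1)) →
  ¬ (∀ m → σ m ≡ Fin.zero) → Shape N σ r' P
pattern-shape N P r' length-P one-gap σ limit additive nonzero with nth N P r' in last
... | inj₁ a = ⊥-elim (nonzero (periodic-at⇒zero r' (λ q →
      trans (letter-periodic q r' (n<1+n r') last) (sym (σ-at-position r' (n<1+n r') last)))))
  where
  open ToeplitzWord N P r' length-P σ limit
  open Additive N σ additive
... | inj₂ f = record
  { length≡ = length-P
  ; letter = letter
  ; gap = f
  ; gap-at-end = last
  ; gap-on-σ = λ q → sym (σ-at-gap q)
  }
  where
  open Words N
  open ToeplitzWord N P r' length-P σ limit
  letters : ∀ s → s < r' → HasLetter P s
  letters = letters-before-gap P r' one-gap (subst (r' <_) (sym length-P) (n<1+n r')) last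
  letter : ∀ j → j < r' → nth N P j ≡ inj₁ (σ j)
  letter j j<r with letters j j<r
  ... | a , eq = trans eq (cong inj₁ (sym (σ-at-position j (m<n⇒m<1+n j<r) eq)))
  open GapLast letters last

pattern-periodic : ∀ N (P : List (Sym N)) r' → length P ≡ suc r' →
  (σ : ℕ → Σ' N) → IsToeplitzLimit N P σ → Shape N σ r' P → PeriodicBelow σ r'
pattern-periodic N P r' length-P σ limit S j q j<r =
  letter-periodic q j (m<n⇒m<1+n j<r) (Shape.letter S j j<r)
  where open ToeplitzWord N P r' length-P σ limit

-- Q = a₀ … a_{p'-1} ρ_{σ p'} with a_s = σ s: substituting the blocks
-- a₀ … a_{p'-1} ρ_{σ p'}(x) maps Shape c to Shape (c+1)(p'+1) - 1, hence
-- Q^(n) has Shape (p'+1)^n - 1.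
module SelfSimilarity (N : ℕ) (σ : ℕ → Σ' N) (additive : CompletelyAdditive N (λ m → σ (m ∸ 1)))
  (p' : ℕ) (L : List (Sym N)) (length-L : length L ≡ p')
  (letter-L : ∀ s → s < p' → nth N L s ≡ inj₁ (σ s))
  (block-periodic : ∀ s i → s < p' → σ (s + i * suc p') ≡ σ s) where

  open Words N
  open Additive N σ additive using (σ-mul; shift-by)

  gapFree-L : gapCount N L ≡ 0
  gapFree-L = letters⇒gapFree L (λ s s< → σ s , letter-L s (subst (s <_) length-L s<))

  open LastGap L (ρ N (σ p')) gapFree-L

  length-block : ∀ x → length (block x) ≡ suc p'
  length-block x = trans (length-++ L) (trans (cong (_+ 1) length-L) (+-comm p' 1))

  nth-block-last : ∀ x → nth N (block x) p' ≡ apply N (ρ N (σ p')) x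
  nth-block-last x = begin
    nth N (block x) p'             ≡⟨ cong (nth N (block x)) (trans (sym (+-identityʳ p')) (cong (_+ 0) (sym length-L))) ⟩
    nth N (block x) (length L + 0) ≡⟨ nth-++ʳ L _ 0 ⟩
    apply N (ρ N (σ p')) x         ∎

  open BlockSubstitution block length-block

  module Step {c R} (S : Shape N σ c R) where
    open Shape S

    c' : ℕ
    c' = p' + c * suc p'

    letter-in-block : ∀ s i → s < suc p' → s + i * suc p' < c' →
      nth N (concatMap block R) (s + i * suc p') ≡ inj₁ (σ (s + i * suc p'))
    letter-in-block s i s<p j<c' with m≤n⇒m<n∨m≡n (≤-pred s<p)
    ... | inj₁ s<p' = begin
      nth N (concatMap block R) (s + i * suc p')  ≡⟨ nth-concatMap R i s i<R s<p ⟩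
      nth N (block (nth N R i)) s                 ≡⟨ nth-++ˡ L _ (subst (s <_) (sym length-L) s<p') ⟩
      nth N L s                                   ≡⟨ letter-L s s<p' ⟩
      inj₁ (σ s)                                  ≡⟨ cong inj₁ (block-periodic s i s<p') ⟨
      inj₁ (σ (s + i * suc p'))                   ∎
      where
      i<R : i < length R
      i<R = subst (i <_) (sym length≡)
        (*-cancelʳ-< (suc p') i (suc c) (≤-<-trans (m≤n+m (i * suc p') s) (m<n⇒m<1+n j<c')))
    ... | inj₂ refl = begin
      nth N (concatMap block R) (s + i * suc p')  ≡⟨ nth-concatMap R i s i<R s<p ⟩
      nth N (block (nth N R i)) s                 ≡⟨ nth-block-last (nth N R i) ⟩
      apply N (ρ N (σ s)) (nth N R i)             ≡⟨ cong (apply N (ρ N (σ s))) (letter i i<c) ⟩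
      inj₁ (_⊕_ N (σ i) (σ s))                    ≡⟨ cong inj₁ (σ-mul i s) ⟨
      inj₁ (σ (s + i * suc p'))                   ∎
      where
      i<c : i < c
      i<c = *-cancelʳ-< (suc p') i c (+-cancelˡ-< s (i * suc p') (c * suc p') j<c')
      i<R : i < length R
      i<R = subst (i <_) (sym length≡) (m<n⇒m<1+n i<c)

    shape-step : Shape N σ c' (concatMap block R)
    shape-step = record
      { length≡ = trans (length-concatMap R) (cong (_* suc p') length≡)
      ; letter = λ j j<c' → subst (λ z → nth N (concatMap block R) z ≡ inj₁ (σ z)) (sym (split j))
          (letter-in-block (j % suc p') (j / suc p') (m%n<n j (suc p')) (subst (_< c') (split j) j<c'))
      ; gap = ρ N (σ p') ∘ gap
      ; gap-at-end = trans (nth-concatMap R c p' (subst (c <_) (sym length≡) (n<1+n c)) (n<1+n p'))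
          (trans (nth-block-last (nth N R c)) (cong (apply N (ρ N (σ p'))) gap-at-end))
      ; gap-on-σ = λ q → trans (cong (ρ N (σ p')) (gap-on-σ q)) (shift-by p' c q)
      }
      where
      split : ∀ j → j ≡ j % suc p' + (j / suc p') * suc p'
      split j = m≡m%n+[m/n]*n j (suc p')

  iter-shape : ∀ n → ∃[ c ] (suc c ≡ suc p' ^ n × Shape N σ c (iter N Q n))
  iter-shape zero = 0 , refl , record
    { length≡ = refl ; letter = λ _ () ; gap = id ; gap-at-end = refl
    ; gap-on-σ = λ q → cong σ (sym (*-identityʳ q)) }
  iter-shape (suc n) with iter-shape n
  ... | c , size , S = Step.c' S , trans (cong (_* suc p') size) (*-comm (suc p' ^ n) (suc p')) ,
        subst (Shape N σ (Step.c' S)) (sym (iter-unfold n)) (Step.shape-step S)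

power-split : ∀ {p k} → 2 ≤ p → 2 ≤ k →
  ∃[ p' ] ∃[ e' ] (p ≡ suc p' × p ^ k ≡ suc (e' + p' * suc e') × p' < e' + p' * suc e')
power-split {suc (suc p'')} {suc (suc k'')} (s≤s (s≤s _)) (s≤s (s≤s _)) =
  suc p'' , e' , refl , cong (p *_) (sym p^[k-1]≡) ,
  <-≤-trans (s≤s p'≤e') (≤-trans (s≤s (m≤m+n e' _)) (≤-reflexive (sym (+-suc e' _))))
  where
  p e' : ℕ
  p = suc (suc p'')
  e' = pred (p ^ suc k'')
  p^[k-1]≡ : suc e' ≡ p ^ suc k''
  p^[k-1]≡ = suc-pred (p ^ suc k'') {{m^n≢0 p (suc k'')}}
  p'≤e' : suc p'' ≤ e'
  p'≤e' = ≤-pred (subst (p ≤_) (sym p^[k-1]≡) (m≤m*n p (p ^ k'') {{m^n≢0 p k''}}))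

mainTheorem14 : (N : ℕ) (P : List (Sym N)) →
    IsPattern N P →
    (∃[ a ] ∃[ w ] (P ≡ inj₁ a ∷ w)) →
    gapCount N P ≡ 1 →
    (σ : ℕ → Σ' N) → IsToeplitzLimit N P σ →
    CompletelyAdditive N (λ m → σ (m ∸ 1)) →
    ¬ (∀ m → σ m ≡ Fin.zero) →
    (p k : ℕ) → Prime p → 2 ≤ k → length P ≡ p ^ k →
    ∃[ b ] ((nth N P (p ∸ 1) ≡ inj₁ b)
    × PatEq N σ P (iter N (take (p ∸ 1) P ++ (inj₂ (ρ N b) ∷ [])) k))
mainTheorem14 N P _ _ one-gap σ limit additive nonzero p k p-prime 2≤k length-P
  with power-split (nonTrivial⇒n>1 p {{prime⇒nonTrivial p-prime}}) 2≤k
... | p' , e' , refl , p^k≡r , p'<r' =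
  σ p' , Shape.letter shape-P p' p'<r' , shape⇒PatEq shape-P shape-Qᵏ
  where
  open Words N
  r' : ℕ
  r' = e' + p' * suc e'
  length-P' : length P ≡ suc r'
  length-P' = trans length-P p^k≡r
  shape-P : Shape N σ r' P
  shape-P = pattern-shape N P r' length-P' one-gap σ limit additive nonzero
  length-L : length (take p' P) ≡ p'
  length-L = trans (length-take p' P) (m≤n⇒m⊓n≡m (subst (p' ≤_) (sym length-P') (m≤n⇒m≤1+n (<⇒≤ p'<r'))))
  letter-L : ∀ s → s < p' → nth N (take p' P) s ≡ inj₁ (σ s)
  letter-L s s<p' = trans (nth-take p' P s<p') (Shape.letter shape-P s (<-trans s<p' p'<r'))
  open SelfSimilarity N σ additive p' (take p' P) length-L letter-L
    (Additive.block-periodic N σ additive p' e' (pattern-periodic N P r' length-P' σ limit shape-P))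
  shape-Qᵏ : Shape N σ r' (iter N (take p' P ++ inj₂ (ρ N (σ p')) ∷ []) k)
  shape-Qᵏ with iter-shape k
  ... | c , size , S with suc-injective (trans size p^k≡r)
  ... | refl = S
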